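{- Let $1\leq t\leq k-2$ and $2k\leq n$, let $\mathcal{F}\subseteq\binom{[n]}{k}$ be a maximal $t$-intersecting family with $\tau_t(\mathcal{F})=t+1$, and let $\mathcal{T}=\{T\in\binom{[n]}{t+1}: |T\cap F|\geq t \text{ for all } F\in\mathcal{F}\}$. Suppose that $\tau_t(\mathcal{T})=t$, that $M=\bigcup_{T\in\mathcal{T}}T$ satisfies $|M|=k$, and that $X$ is a $t$-subset of $[n]$ contained in every $T\in\mathcal{T}$. Set $C=M\cup\bigcup_{F\in\mathcal{F}\setminus\mathcal{F}_X}F$ and $c=|C|$. Then either $k+2\leq c\leq 2k-t$ or $c=n$. Moreover: (i) if $k+2\leq c\leq 2k-t$, then $\mathcal{F}=\mathcal{H}_1(X,M,C)$; (ii) if $c=n$, then $t\neq k-2$ and $\mathcal{F}=\mathcal{H}_1(X,M,[n])$.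
   Context: $\binom{[n]}{k}$ denotes the family of $k$-subsets of $[n]=\{1,\ldots,n\}$. A family $\mathcal{G}$ of sets is $t$-intersecting if $|A\cap B|\geq t$ for all $A,B\in\mathcal{G}$. "Maximal" means maximal under inclusion among $t$-intersecting subfamilies of $\binom{[n]}{k}$. The $t$-covering number $\tau_t(\mathcal{G})$ of a family $\mathcal{G}$ of subsets of $[n]$ is the minimum size of a subset $T\subseteq[n]$ with $|T\cap G|\geq t$ for all $G\in\mathcal{G}$. For a set $S$, $\mathcal{F}_S=\{F\in\mathcal{F}: S\subseteq F\}$. For $X\subseteq M\subseteq C\subseteq[n]$ with $|X|=t$, $|M|=k$, $|C|=c$: $\mathcal{H}_1(X,M,C)=\mathcal{A}(X,M)\cup\mathcal{B}(X,M,C)\cup\mathcal{C}(X,M,C)$ where $\mathcal{A}(X,M)=\{F\in\binom{[n]}{k}: X\subseteq F,\ |F\cap M|\geq t+1\}$, $\mathcal{B}(X,M,C)=\{F\in\binom{[n]}{k}: F\cap M=X,\ |F\cap C|=c-k+t\}$, $\mathcal{C}(X,M,C)=\{F\in\binom{C}{k}: |F\cap X|=t-1,\ |F\cap M|=k-1\}$. -}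

module Defs where

open import Data.Nat using (ℕ; _+_; _∸_; _≤_)
open import Data.Fin using (Fin)
open import Data.Fin.Subset using (Subset; _∈_; _⊆_; _∩_; _∪_; ∣_∣)
open import Data.Product using (Σ; _×_; ∃)
open import Data.Sum using (_⊎_)
open import Relation.Nullary using (¬_)
open import Relation.Binary.PropositionalEquality using (_≡_)
open import Level using (suc; zero)

Family : ℕ → Set₁
Family n = Subset n → Set

_⊑_ : ∀ {n} → Family n → Family n → Set
𝓕 ⊑ 𝓖 = ∀ F → 𝓕 F → 𝓖 F

_≐_ : ∀ {n} → Family n → Family n → Set
𝓕 ≐ 𝓖 = 𝓕 ⊑ 𝓖 × 𝓖 ⊑ 𝓕

IsUniform : ∀ {n} → ℕ → Family n → Set
IsUniform k 𝓖 = ∀ F → 𝓖 F → ∣ F ∣ ≡ k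

IsTIntersecting : ∀ {n} → ℕ → Family n → Set
IsTIntersecting t 𝓖 = ∀ A B → 𝓖 A → 𝓖 B → t ≤ ∣ A ∩ B ∣

IsMaximalTIntersecting : ∀ {n} → ℕ → ℕ → Family n → Set₁
IsMaximalTIntersecting {n} k t 𝓕 =
  IsUniform k 𝓕 × IsTIntersecting t 𝓕 ×
  (∀ (𝓖 : Family n) → IsUniform k 𝓖 → IsTIntersecting t 𝓖 → 𝓕 ⊑ 𝓖 → 𝓖 ⊑ 𝓕)

IsTCover : ∀ {n} → ℕ → Family n → Subset n → Set
IsTCover t 𝓖 T = ∀ G → 𝓖 G → t ≤ ∣ T ∩ G ∣

CoveringNumber≡ : ∀ {n} → ℕ → Family n → ℕ → Set
CoveringNumber≡ t 𝓖 m =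
  Σ _ (λ T → IsTCover t 𝓖 T × ∣ T ∣ ≡ m) × (∀ T → IsTCover t 𝓖 T → m ≤ ∣ T ∣)

𝓣 : ∀ {n} → ℕ → Family n → Family n
𝓣 t 𝓕 T = ∣ T ∣ ≡ t + 1 × IsTCover t 𝓕 T

𝓐 : ∀ {n} → ℕ → ℕ → Subset n → Subset n → Family n
𝓐 k t X M F = ∣ F ∣ ≡ k × X ⊆ F × t + 1 ≤ ∣ F ∩ M ∣

𝓑 : ∀ {n} → ℕ → ℕ → Subset n → Subset n → Subset n → Family n
𝓑 k t X M C F = ∣ F ∣ ≡ k × F ∩ M ≡ X × ∣ F ∩ C ∣ ≡ (∣ C ∣ ∸ k) + t

𝓒 : ∀ {n} → ℕ → ℕ → Subset n → Subset n → Subset n → Family n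
𝓒 k t X M C F = ∣ F ∣ ≡ k × F ⊆ C × ∣ F ∩ X ∣ ≡ t ∸ 1 × ∣ F ∩ M ∣ ≡ k ∸ 1

𝓗₁ : ∀ {n} → ℕ → ℕ → Subset n → Subset n → Subset n → Family n
𝓗₁ k t X M C F = 𝓐 k t X M F ⊎ 𝓑 k t X M C F ⊎ 𝓒 k t X M C F

-- Every T ∈ 𝓣 is X ∪ {m} with m ∈ M ∖ X, and every such set is a t-cover of 𝓕.  Hence a
-- member F with X ⊈ F contains M ∖ X and misses exactly one point of X, so F ∈ 𝓒(X,M,C); a member
-- F ⊇ X with |F ∩ M| ≤ t meets M exactly in X and contains C ∖ M, so F ∈ 𝓑(X,M,C); all other
-- members lie in 𝓐(X,M).  As 𝓗₁(X,M,C) is itself k-uniform and t-intersecting, maximality gives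
-- 𝓕 = 𝓗₁(X,M,C) for every value of |C|.  Moreover |C| ≥ k + 2, for otherwise X would be a t-cover
-- of size t.  If |C| > 2k − t then 𝓑 = ∅, so every member meets M⁻ = M ∖ {x} (x ∈ X) in at least
-- t points; by maximality M⁻ ∪ {y} ∈ 𝓕 for each y ∉ C, forcing C = [n], and for t = k − 2 the set
-- M⁻ would lie in 𝓣 while avoiding x ∈ X.

module Submission where

open import Defs
open import Data.Nat using (ℕ; zero; suc; _+_; _*_; _∸_; _≤_; _<_; _≤?_; z≤n; s≤s)
open import Data.Nat.Properties hiding (_≟_)
open import Data.Bool using (true; false)
open import Data.Vec using ([]; _∷_; here; there)
open import Data.Fin using (Fin; zero; suc; _≟_)
open import Data.Fin.Subset using (Subset; _∈_; _∉_; _⊆_; _∩_; _∪_; ∣_∣; ∁; ⁅_⁆; ⊤; ⊥)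
open import Data.Fin.Subset.Properties
open import Data.Product using (Σ; ∃; _×_; _,_; proj₁; proj₂)
open import Data.Sum using (_⊎_; inj₁; inj₂)
open import Data.Empty using (⊥-elim)
open import Relation.Nullary using (¬_; yes; no)
open import Relation.Binary.PropositionalEquality

private
  variable
    n : ℕ

∣∩∣+∣∩∁∣ : (A B : Subset n) → ∣ A ∣ ≡ ∣ A ∩ B ∣ + ∣ A ∩ ∁ B ∣
∣∩∣+∣∩∁∣ []          []          = refl
∣∩∣+∣∩∁∣ (false ∷ A) (_ ∷ B)     = ∣∩∣+∣∩∁∣ A B
∣∩∣+∣∩∁∣ (true ∷ A)  (true ∷ B)  = cong suc (∣∩∣+∣∩∁∣ A B)
∣∩∣+∣∩∁∣ (true ∷ A)  (false ∷ B) = trans (cong suc (∣∩∣+∣∩∁∣ A B)) (sym (+-suc _ _))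

∣∪∣+∣∩∣ : (A B : Subset n) → ∣ A ∪ B ∣ + ∣ A ∩ B ∣ ≡ ∣ A ∣ + ∣ B ∣
∣∪∣+∣∩∣ []          []          = refl
∣∪∣+∣∩∣ (false ∷ A) (false ∷ B) = ∣∪∣+∣∩∣ A B
∣∪∣+∣∩∣ (true ∷ A)  (false ∷ B) = cong suc (∣∪∣+∣∩∣ A B)
∣∪∣+∣∩∣ (false ∷ A) (true ∷ B)  = trans (cong suc (∣∪∣+∣∩∣ A B)) (sym (+-suc _ _))
∣∪∣+∣∩∣ (true ∷ A)  (true ∷ B)  =
  cong suc (trans (+-suc _ _) (trans (cong suc (∣∪∣+∣∩∣ A B)) (sym (+-suc _ _))))

⊆-∣∣-≥⇒⊇ : {A B : Subset n} → A ⊆ B → ∣ B ∣ ≤ ∣ A ∣ → B ⊆ A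
⊆-∣∣-≥⇒⊇ {A = []}        {[]}        _   _        ()
⊆-∣∣-≥⇒⊇ {A = false ∷ A} {false ∷ B} A⊆B le       = s⊆s (⊆-∣∣-≥⇒⊇ (drop-∷-⊆ A⊆B) le)
⊆-∣∣-≥⇒⊇ {A = true ∷ A}  {true ∷ B}  A⊆B (s≤s le) = s⊆s (⊆-∣∣-≥⇒⊇ (drop-∷-⊆ A⊆B) le)
⊆-∣∣-≥⇒⊇ {A = false ∷ A} {true ∷ B}  A⊆B le       =
  ⊥-elim (<⇒≱ le (p⊆q⇒∣p∣≤∣q∣ (drop-∷-⊆ A⊆B)))
⊆-∣∣-≥⇒⊇ {A = true ∷ A}  {false ∷ B} A⊆B _ with A⊆B here
... | ()

⊆⊇⇒∣∣≡ : (A B : Subset n) → A ⊆ B → B ⊆ A → ∣ A ∣ ≡ ∣ B ∣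
⊆⊇⇒∣∣≡ _ _ A⊆B B⊆A = cong ∣_∣ (⊆-antisym A⊆B B⊆A)

∣∣≥1⇒∃∈ : (A : Subset n) → 1 ≤ ∣ A ∣ → ∃ λ i → i ∈ A
∣∣≥1⇒∃∈ (true ∷ A)  _  = zero , here
∣∣≥1⇒∃∈ (false ∷ A) le with ∣∣≥1⇒∃∈ A le
... | i , i∈A = suc i , there i∈A

∩⁺ : {A B : Subset n} {i : Fin n} → i ∈ A → i ∈ B → i ∈ A ∩ B
∩⁺ i∈A i∈B = x∈p∩q⁺ (i∈A , i∈B)

∩ˡ : {A B : Subset n} {i : Fin n} → i ∈ A ∩ B → i ∈ A
∩ˡ {A = A} {B} p = proj₁ (x∈p∩q⁻ A B p)

∩ʳ : {A B : Subset n} {i : Fin n} → i ∈ A ∩ B → i ∈ B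
∩ʳ {A = A} {B} p = proj₂ (x∈p∩q⁻ A B p)

∣∪∣-disjoint : {A B : Subset n} → (∀ {i} → i ∈ A → i ∉ B) → ∣ A ∪ B ∣ ≡ ∣ A ∣ + ∣ B ∣
∣∪∣-disjoint {n} {A} {B} disj = begin
  ∣ A ∪ B ∣              ≡⟨ sym (+-identityʳ _) ⟩
  ∣ A ∪ B ∣ + 0          ≡⟨ cong (∣ A ∪ B ∣ +_) (sym ∣A∩B∣≡0) ⟩
  ∣ A ∪ B ∣ + ∣ A ∩ B ∣  ≡⟨ ∣∪∣+∣∩∣ A B ⟩
  ∣ A ∣ + ∣ B ∣          ∎
  where
    open ≡-Reasoning
    ∣A∩B∣≡0 : ∣ A ∩ B ∣ ≡ 0
    ∣A∩B∣≡0 = n≤0⇒n≡0 (≤-trans (p⊆q⇒∣p∣≤∣q∣ {q = ⊥} (λ p → ⊥-elim (disj (∩ˡ p) (∩ʳ p))))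
                                (≤-reflexive (∣⊥∣≡0 n)))

∣∪∣≤∣∣+∣∣ : (A B : Subset n) → ∣ A ∪ B ∣ ≤ ∣ A ∣ + ∣ B ∣
∣∪∣≤∣∣+∣∣ A B = ≤-trans (m≤m+n _ _) (≤-reflexive (∣∪∣+∣∩∣ A B))

∣∪⁅⁆∣ : {A : Subset n} {x : Fin n} → x ∉ A → ∣ A ∪ ⁅ x ⁆ ∣ ≡ suc ∣ A ∣
∣∪⁅⁆∣ {A = A} {x} x∉A =
  trans (∣∪∣-disjoint (λ i∈A i∈x → x∉A (subst (_∈ A) (x∈⁅y⁆⇒x≡y x i∈x) i∈A)))
        (trans (cong (∣ A ∣ +_) (∣⁅x⁆∣≡1 x)) (+-comm ∣ A ∣ 1))

∣∪⁅⁆∣≤ : (A : Subset n) (x : Fin n) → ∣ A ∪ ⁅ x ⁆ ∣ ≤ suc ∣ A ∣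
∣∪⁅⁆∣≤ A x = ≤-trans (∣∪∣≤∣∣+∣∣ A ⁅ x ⁆)
                     (≤-reflexive (trans (cong (∣ A ∣ +_) (∣⁅x⁆∣≡1 x)) (+-comm ∣ A ∣ 1)))

∉⊆∋⇒∣∣< : {S A : Subset n} {x : Fin n} → x ∉ S → S ⊆ A → x ∈ A → suc ∣ S ∣ ≤ ∣ A ∣
∉⊆∋⇒∣∣< {S = S} {A} {x} x∉S S⊆A x∈A = subst (_≤ ∣ A ∣) (∣∪⁅⁆∣ x∉S) (p⊆q⇒∣p∣≤∣q∣ S∪x⊆A)
  where
    S∪x⊆A : S ∪ ⁅ x ⁆ ⊆ A
    S∪x⊆A p with x∈p∪q⁻ S ⁅ x ⁆ p
    ... | inj₁ i∈S = S⊆A i∈S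
    ... | inj₂ i∈x = subst (_∈ A) (sym (x∈⁅y⁆⇒x≡y x i∈x)) x∈A

∣∣≤1⇒≡ : (A : Subset n) {i j : Fin n} → ∣ A ∣ ≤ 1 → i ∈ A → j ∈ A → i ≡ j
∣∣≤1⇒≡ A {i} {j} le i∈A j∈A with i ≟ j
... | yes i≡j = i≡j
... | no  i≢j = ⊥-elim (<⇒≱ (∉⊆∋⇒∣∣< j∉⁅i⁆ ⁅i⁆⊆A j∈A) (≤-trans le (≤-reflexive (sym (∣⁅x⁆∣≡1 i)))))
  where
    j∉⁅i⁆ : j ∉ ⁅ i ⁆
    j∉⁅i⁆ j∈i = i≢j (sym (x∈⁅y⁆⇒x≡y i j∈i))
    ⁅i⁆⊆A : ⁅ i ⁆ ⊆ A
    ⁅i⁆⊆A k∈i = subst (_∈ A) (sym (x∈⁅y⁆⇒x≡y i k∈i)) i∈A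

∣∩∁⁅⁆∣ : {A : Subset n} {x : Fin n} → x ∈ A → suc ∣ A ∩ ∁ ⁅ x ⁆ ∣ ≡ ∣ A ∣
∣∩∁⁅⁆∣ {A = A} {x} x∈A = sym (trans (∣∩∣+∣∩∁∣ A ⁅ x ⁆) (cong (_+ ∣ A ∩ ∁ ⁅ x ⁆ ∣) ∣A∩x∣≡1))
  where
    ∣A∩x∣≡1 : ∣ A ∩ ⁅ x ⁆ ∣ ≡ 1
    ∣A∩x∣≡1 = trans (⊆⊇⇒∣∣≡ (A ∩ ⁅ x ⁆) ⁅ x ⁆ ∩ʳ (λ p → ∩⁺ (subst (_∈ A) (sym (x∈⁅y⁆⇒x≡y x p)) x∈A) p))
                    (∣⁅x⁆∣≡1 x)

∣∩∁⁅⁆∣≥ : (A : Subset n) (x : Fin n) → ∣ A ∣ ≤ suc ∣ A ∩ ∁ ⁅ x ⁆ ∣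
∣∩∁⁅⁆∣≥ A x = ≤-trans (≤-reflexive (∣∩∣+∣∩∁∣ A ⁅ x ⁆))
                      (+-monoˡ-≤ _ (≤-trans (∣p∩q∣≤∣q∣ A ⁅ x ⁆) (≤-reflexive (∣⁅x⁆∣≡1 x))))

∣∣≡∣⊆∣+∣∩∁∣ : {A B : Subset n} → B ⊆ A → ∣ A ∣ ≡ ∣ B ∣ + ∣ A ∩ ∁ B ∣
∣∣≡∣⊆∣+∣∩∁∣ {A = A} {B} B⊆A =
  trans (∣∩∣+∣∩∁∣ A B) (cong (_+ ∣ A ∩ ∁ B ∣) (⊆⊇⇒∣∣≡ (A ∩ B) B ∩ʳ (λ p → ∩⁺ (B⊆A p) p)))

∣∣+∣∣≤∣∣+∣∩∣ : {A B X : Subset n} → A ⊆ X → B ⊆ X → ∣ A ∣ + ∣ B ∣ ≤ ∣ X ∣ + ∣ A ∩ B ∣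
∣∣+∣∣≤∣∣+∣∩∣ {A = A} {B} {X} A⊆X B⊆X =
  ≤-trans (≤-reflexive (sym (∣∪∣+∣∩∣ A B))) (+-monoˡ-≤ ∣ A ∩ B ∣ (p⊆q⇒∣p∣≤∣q∣ A∪B⊆X))
  where
    A∪B⊆X : A ∪ B ⊆ X
    A∪B⊆X p with x∈p∪q⁻ A B p
    ... | inj₁ i∈A = A⊆X i∈A
    ... | inj₂ i∈B = B⊆X i∈B

⊈⇒∣∩∣< : {X F : Subset n} → ¬ (X ⊆ F) → ∣ F ∩ X ∣ < ∣ X ∣
⊈⇒∣∩∣< {X = X} {F} X⊈F with ∣ X ∣ ≤? ∣ F ∩ X ∣
... | yes le = ⊥-elim (X⊈F (λ p → ∩ˡ (⊆-∣∣-≥⇒⊇ (p∩q⊆q F X) le p)))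
... | no  nle = ≰⇒> nle

one-point-extension : {X T : Subset n} {m : Fin n} →
  X ⊆ T → ∣ T ∣ ≡ suc ∣ X ∣ → m ∈ T → m ∉ X → T ⊆ X ∪ ⁅ m ⁆
one-point-extension {X = X} {T} {m} X⊆T ∣T∣ m∈T m∉X {i} i∈T with i ∈? X
... | yes i∈X = x∈p∪q⁺ (inj₁ i∈X)
... | no  i∉X = x∈p∪q⁺ (inj₂ (subst (_∈ ⁅ m ⁆) (sym i≡m) (x∈⁅x⁆ m)))
  where
    ∣T∖X∣≡1 : ∣ T ∩ ∁ X ∣ ≡ 1
    ∣T∖X∣≡1 = +-cancelˡ-≡ ∣ X ∣ _ _
      (trans (sym (∣∣≡∣⊆∣+∣∩∁∣ X⊆T)) (trans ∣T∣ (+-comm 1 ∣ X ∣)))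
    i≡m : i ≡ m
    i≡m = ∣∣≤1⇒≡ (T ∩ ∁ X) (≤-reflexive ∣T∖X∣≡1) (∩⁺ i∈T (x∉p⇒x∈∁p i∉X)) (∩⁺ m∈T (x∉p⇒x∈∁p m∉X))

≤∸2⇒+2≤ : ∀ {t k} → 1 ≤ t → t ≤ k ∸ 2 → t + 2 ≤ k
≤∸2⇒+2≤ {suc t} {zero}       _ ()
≤∸2⇒+2≤ {suc t} {suc zero}   _ ()
≤∸2⇒+2≤ {t}     {suc (suc k)} _ t≤k∸2 = subst (t + 2 ≤_) (+-comm k 2) (+-monoˡ-≤ 2 t≤k∸2)

suc-∸1 : ∀ {a m} → 1 ≤ m → a ≡ m ∸ 1 → suc a ≡ m
suc-∸1 {m = suc m} _ refl = refl

+-≤-2*∸ : ∀ {s t k} → t ≤ k → s + t ≤ k → k + s ≤ 2 * k ∸ t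
+-≤-2*∸ {s} {t} {k} t≤k s+t≤k = begin
  k + s            ≤⟨ +-monoʳ-≤ k (m+n≤o⇒m≤o∸n s s+t≤k) ⟩
  k + (k ∸ t)      ≡⟨ sym (+-∸-assoc k t≤k) ⟩
  (k + k) ∸ t      ≡⟨ cong (λ z → (k + z) ∸ t) (sym (+-identityʳ k)) ⟩
  2 * k ∸ t        ∎
  where open ≤-Reasoning

cover-mono : ∀ {t} {𝓖 : Family n} {T T′ : Subset n} →
  T ⊆ T′ → IsTCover t 𝓖 T → IsTCover t 𝓖 T′
cover-mono T⊆T′ cov G G∈𝓖 = ≤-trans (cov G G∈𝓖) (p⊆q⇒∣p∣≤∣q∣ (λ p → ∩⁺ (T⊆T′ (∩ˡ p)) (∩ʳ p)))

common-core : {X F G : Subset n} → X ⊆ F → X ⊆ G → ∣ X ∣ ≤ ∣ F ∩ G ∣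
common-core X⊆F X⊆G = p⊆q⇒∣p∣≤∣q∣ (λ p → ∩⁺ (X⊆F p) (X⊆G p))

∩-sym-≤ : ∀ {t} (F G : Subset n) → t ≤ ∣ F ∩ G ∣ → t ≤ ∣ G ∩ F ∣
∩-sym-≤ F G = subst (_ ≤_) (cong ∣_∣ (∩-comm F G))

maximal-adjoin : ∀ {k t} {𝓕 : Family n} → IsMaximalTIntersecting k t 𝓕 → t ≤ k →
  (G : Subset n) → ∣ G ∣ ≡ k → (∀ F → 𝓕 F → t ≤ ∣ F ∩ G ∣) → 𝓕 G
maximal-adjoin {n} {k} {t} {𝓕} (uniform , intersecting , maximal) t≤k G ∣G∣ meets =
  maximal 𝓕+G uniform+ intersecting+ (λ _ → inj₁) G (inj₂ refl)
  where
    𝓕+G : Family n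
    𝓕+G F = 𝓕 F ⊎ F ≡ G
    uniform+ : IsUniform k 𝓕+G
    uniform+ F (inj₁ F∈𝓕) = uniform F F∈𝓕
    uniform+ F (inj₂ refl) = ∣G∣
    intersecting+ : IsTIntersecting t 𝓕+G
    intersecting+ A B (inj₁ A∈𝓕) (inj₁ B∈𝓕) = intersecting A B A∈𝓕 B∈𝓕
    intersecting+ A B (inj₁ A∈𝓕) (inj₂ refl) = meets A A∈𝓕
    intersecting+ A B (inj₂ refl) (inj₁ B∈𝓕) = ∩-sym-≤ B A (meets B B∈𝓕)
    intersecting+ A B (inj₂ refl) (inj₂ refl) =
      subst (t ≤_) (trans (sym ∣G∣) (cong ∣_∣ (sym (∩-idem G)))) t≤k

maximal-≐ : ∀ {k t} {𝓕 𝓗 : Family n} → IsMaximalTIntersecting k t 𝓕 →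
  IsUniform k 𝓗 → IsTIntersecting t 𝓗 → 𝓕 ⊑ 𝓗 → 𝓕 ≐ 𝓗
maximal-≐ {𝓗 = 𝓗} (_ , _ , maximal) uniform intersecting 𝓕⊑𝓗 =
  𝓕⊑𝓗 , maximal 𝓗 uniform intersecting 𝓕⊑𝓗

module H₁-Structure {k t : ℕ} {X M C : Subset n}
  (1≤t : 1 ≤ t) (t+2≤k : t + 2 ≤ k)
  (∣X∣ : ∣ X ∣ ≡ t) (∣M∣ : ∣ M ∣ ≡ k) (X⊆M : X ⊆ M) (M⊆C : M ⊆ C) where

  r : ℕ
  r = ∣ M ∩ ∁ X ∣

  k≡t+r : k ≡ t + r
  k≡t+r = trans (sym ∣M∣) (trans (∣∣≡∣⊆∣+∣∩∁∣ X⊆M) (cong (_+ r) ∣X∣))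

  2≤r : 2 ≤ r
  2≤r = +-cancelˡ-≤ t 2 r (subst (t + 2 ≤_) k≡t+r t+2≤k)

  1≤k : 1 ≤ k
  1≤k = ≤-trans (s≤s z≤n) (≤-trans (m≤n+m 2 t) t+2≤k)

  ∣∩M∣-split : (F : Subset n) → ∣ F ∩ M ∣ ≡ ∣ F ∩ X ∣ + ∣ (F ∩ M) ∩ ∁ X ∣
  ∣∩M∣-split F = trans (∣∩∣+∣∩∁∣ (F ∩ M) X) (cong (_+ ∣ (F ∩ M) ∩ ∁ X ∣) ∣F∩M∩X∣)
    where
      ∣F∩M∩X∣ : ∣ (F ∩ M) ∩ X ∣ ≡ ∣ F ∩ X ∣
      ∣F∩M∩X∣ = ⊆⊇⇒∣∣≡ ((F ∩ M) ∩ X) (F ∩ X) (λ p → ∩⁺ (∩ˡ (∩ˡ p)) (∩ʳ p))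
                                             (λ p → ∩⁺ (∩⁺ (∩ˡ p) (X⊆M (∩ʳ p))) (∩ʳ p))

  ∣C∣≡k+∣C∖M∣ : ∣ C ∣ ≡ k + ∣ C ∩ ∁ M ∣
  ∣C∣≡k+∣C∖M∣ = trans (∣∣≡∣⊆∣+∣∩∁∣ M⊆C) (cong (_+ ∣ C ∩ ∁ M ∣) ∣M∣)

  ∣C∖M∣≡∣C∣∸k : ∣ C ∩ ∁ M ∣ ≡ ∣ C ∣ ∸ k
  ∣C∖M∣≡∣C∣∸k = sym (trans (cong (_∸ k) ∣C∣≡k+∣C∖M∣) (m+n∸m≡n k _))

  𝓒-X : ∀ {G} → 𝓒 k t X M C G → suc ∣ G ∩ X ∣ ≡ t
  𝓒-X (_ , _ , ∣G∩X∣ , _) = suc-∸1 1≤t ∣G∩X∣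

  𝓒-core : ∀ {G} → 𝓒 k t X M C G → M ∩ ∁ X ⊆ G
  𝓒-core {G} G∈𝓒@(_ , _ , _ , ∣G∩M∣) p = ∩ˡ (∩ˡ (⊆-∣∣-≥⇒⊇ core⊆ (≤-reflexive (sym ∣core∣≡r)) p))
    where
      core⊆ : (G ∩ M) ∩ ∁ X ⊆ M ∩ ∁ X
      core⊆ q = ∩⁺ (∩ʳ (∩ˡ q)) (∩ʳ q)
      ∣core∣≡r : ∣ (G ∩ M) ∩ ∁ X ∣ ≡ r
      ∣core∣≡r = +-cancelˡ-≡ (suc ∣ G ∩ X ∣) _ _ (begin
        suc ∣ G ∩ X ∣ + ∣ (G ∩ M) ∩ ∁ X ∣  ≡⟨ cong suc (sym (∣∩M∣-split G)) ⟩
        suc ∣ G ∩ M ∣                       ≡⟨ suc-∸1 1≤k ∣G∩M∣ ⟩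
        k                                   ≡⟨ k≡t+r ⟩
        t + r                               ≡⟨ cong (_+ r) (sym (𝓒-X G∈𝓒)) ⟩
        suc ∣ G ∩ X ∣ + r                   ∎)
        where open ≡-Reasoning

  𝓒-outside : ∀ {G} → 𝓒 k t X M C G → ∣ G ∩ ∁ M ∣ ≡ 1
  𝓒-outside {G} (∣G∣ , _ , _ , ∣G∩M∣) = +-cancelˡ-≡ ∣ G ∩ M ∣ _ _ (begin
    ∣ G ∩ M ∣ + ∣ G ∩ ∁ M ∣  ≡⟨ sym (∣∩∣+∣∩∁∣ G M) ⟩
    ∣ G ∣                    ≡⟨ ∣G∣ ⟩
    k                        ≡⟨ sym (suc-∸1 1≤k ∣G∩M∣) ⟩
    suc ∣ G ∩ M ∣            ≡⟨ +-comm 1 _ ⟩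
    ∣ G ∩ M ∣ + 1            ∎)
    where open ≡-Reasoning

  𝓒-intro : ∀ {F} → ∣ F ∣ ≡ k → F ⊆ C → suc ∣ F ∩ X ∣ ≡ t → M ∩ ∁ X ⊆ F → 𝓒 k t X M C F
  𝓒-intro {F} ∣F∣ F⊆C ∣F∩X∣ core = ∣F∣ , F⊆C , cong (_∸ 1) ∣F∩X∣ , cong (_∸ 1) suc∣F∩M∣≡k
    where
      ∣core∣≡r : ∣ (F ∩ M) ∩ ∁ X ∣ ≡ r
      ∣core∣≡r = ⊆⊇⇒∣∣≡ ((F ∩ M) ∩ ∁ X) (M ∩ ∁ X) (λ q → ∩⁺ (∩ʳ (∩ˡ q)) (∩ʳ q))
                                                  (λ q → ∩⁺ (∩⁺ (core q) (∩ˡ q)) (∩ʳ q))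
      suc∣F∩M∣≡k : suc ∣ F ∩ M ∣ ≡ k
      suc∣F∩M∣≡k = begin
        suc ∣ F ∩ M ∣                       ≡⟨ cong suc (∣∩M∣-split F) ⟩
        suc ∣ F ∩ X ∣ + ∣ (F ∩ M) ∩ ∁ X ∣  ≡⟨ cong₂ _+_ ∣F∩X∣ ∣core∣≡r ⟩
        t + r                               ≡⟨ sym k≡t+r ⟩
        k                                   ∎
        where open ≡-Reasoning

  ∣∩C∣-split : ∀ {F} → F ∩ M ≡ X → ∣ F ∩ C ∣ ≡ t + ∣ (F ∩ C) ∩ ∁ M ∣
  ∣∩C∣-split {F} F∩M≡X = trans (∣∩∣+∣∩∁∣ (F ∩ C) M) (cong (_+ ∣ (F ∩ C) ∩ ∁ M ∣) ∣F∩C∩M∣≡t)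
    where
      ∣F∩C∩M∣≡t : ∣ (F ∩ C) ∩ M ∣ ≡ t
      ∣F∩C∩M∣≡t = trans (⊆⊇⇒∣∣≡ ((F ∩ C) ∩ M) (F ∩ M) (λ p → ∩⁺ (∩ˡ (∩ˡ p)) (∩ʳ p))
                                                    (λ q → ∩⁺ (∩⁺ (∩ˡ q) (M⊆C (∩ʳ q))) (∩ʳ q)))
                        (trans (cong ∣_∣ F∩M≡X) ∣X∣)

  𝓑-intro : ∀ {F} → ∣ F ∣ ≡ k → F ∩ M ≡ X → C ∩ ∁ M ⊆ F → 𝓑 k t X M C F
  𝓑-intro {F} ∣F∣ F∩M≡X rim = ∣F∣ , F∩M≡X , (begin
    ∣ F ∩ C ∣                    ≡⟨ ∣∩C∣-split F∩M≡X ⟩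
    t + ∣ (F ∩ C) ∩ ∁ M ∣        ≡⟨ cong (t +_) ∣F∩C∖M∣ ⟩
    t + ∣ C ∩ ∁ M ∣              ≡⟨ +-comm t _ ⟩
    ∣ C ∩ ∁ M ∣ + t              ≡⟨ cong (_+ t) ∣C∖M∣≡∣C∣∸k ⟩
    (∣ C ∣ ∸ k) + t              ∎)
    where
      open ≡-Reasoning
      ∣F∩C∖M∣ : ∣ (F ∩ C) ∩ ∁ M ∣ ≡ ∣ C ∩ ∁ M ∣
      ∣F∩C∖M∣ = ⊆⊇⇒∣∣≡ ((F ∩ C) ∩ ∁ M) (C ∩ ∁ M) (λ q → ∩⁺ (∩ʳ (∩ˡ q)) (∩ʳ q))
                                                 (λ q → ∩⁺ (∩⁺ (rim q) (∩ˡ q)) (∩ʳ q))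

  𝓑-X : ∀ {F} → 𝓑 k t X M C F → X ⊆ F
  𝓑-X (_ , F∩M≡X , _) p = ∩ˡ (subst (_ ∈_) (sym F∩M≡X) p)

  𝓑-rim : ∀ {F} → 𝓑 k t X M C F → C ∩ ∁ M ⊆ F
  𝓑-rim {F} (_ , F∩M≡X , ∣F∩C∣) p = ∩ˡ (∩ˡ (⊆-∣∣-≥⇒⊇ rim⊆ (≤-reflexive ∣C∖M∣≡∣rim∣) p))
    where
      rim⊆ : (F ∩ C) ∩ ∁ M ⊆ C ∩ ∁ M
      rim⊆ q = ∩⁺ (∩ʳ (∩ˡ q)) (∩ʳ q)
      ∣C∖M∣≡∣rim∣ : ∣ C ∩ ∁ M ∣ ≡ ∣ (F ∩ C) ∩ ∁ M ∣
      ∣C∖M∣≡∣rim∣ = +-cancelʳ-≡ t _ _ (begin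
        ∣ C ∩ ∁ M ∣ + t              ≡⟨ cong (_+ t) ∣C∖M∣≡∣C∣∸k ⟩
        (∣ C ∣ ∸ k) + t              ≡⟨ sym ∣F∩C∣ ⟩
        ∣ F ∩ C ∣                    ≡⟨ ∣∩C∣-split F∩M≡X ⟩
        t + ∣ (F ∩ C) ∩ ∁ M ∣        ≡⟨ +-comm t _ ⟩
        ∣ (F ∩ C) ∩ ∁ M ∣ + t        ∎)
        where open ≡-Reasoning

  𝓑-bound : ∀ {F} → 𝓑 k t X M C F → ∣ C ∣ ≤ 2 * k ∸ t
  𝓑-bound {F} (∣F∣ , _ , ∣F∩C∣) = subst (_≤ 2 * k ∸ t) (sym ∣C∣≡k+∣C∖M∣)
    (+-≤-2*∸ (≤-trans (m≤m+n t 2) t+2≤k)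
             (subst (_≤ k) (trans ∣F∩C∣ (cong (_+ t) (sym ∣C∖M∣≡∣C∣∸k)))
                    (≤-trans (∣p∩q∣≤∣p∣ F C) (≤-reflexive ∣F∣))))

  𝓒-meet : ∀ {F G o} → X ⊆ F → 𝓒 k t X M C G → o ∈ F → o ∈ G → o ∉ X → t ≤ ∣ F ∩ G ∣
  𝓒-meet {F} {G} X⊆F G∈𝓒 o∈F o∈G o∉X = subst (_≤ ∣ F ∩ G ∣) (𝓒-X G∈𝓒)
    (∉⊆∋⇒∣∣< (λ p → o∉X (∩ʳ p)) (λ p → ∩⁺ (X⊆F (∩ʳ p)) (∩ˡ p)) (∩⁺ o∈F o∈G))

  𝓒-outside-point : ∀ {G} → 𝓒 k t X M C G → ∃ λ o → o ∈ G ∩ ∁ M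
  𝓒-outside-point {G} G∈𝓒 = ∣∣≥1⇒∃∈ (G ∩ ∁ M) (≤-reflexive (sym (𝓒-outside G∈𝓒)))

  𝓐-point : ∀ {F} → 𝓐 k t X M F → ∃ λ o → o ∈ (F ∩ M) ∩ ∁ X
  𝓐-point {F} (_ , _ , t+1≤∣F∩M∣) = ∣∣≥1⇒∃∈ ((F ∩ M) ∩ ∁ X)
    (+-cancelˡ-≤ t 1 _ (≤-trans (subst (t + 1 ≤_) (∣∩M∣-split F) t+1≤∣F∩M∣)
                                (+-monoˡ-≤ _ (subst (∣ F ∩ X ∣ ≤_) ∣X∣ (∣p∩q∣≤∣q∣ F X)))))

  𝓐𝓑-X : ∀ {F} → 𝓐 k t X M F ⊎ 𝓑 k t X M C F → X ⊆ F
  𝓐𝓑-X (inj₁ (_ , X⊆F , _)) = X⊆F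
  𝓐𝓑-X (inj₂ F∈𝓑) = 𝓑-X F∈𝓑

  𝓐𝓑-meets-𝓒 : ∀ {F G} → 𝓐 k t X M F ⊎ 𝓑 k t X M C F → 𝓒 k t X M C G → t ≤ ∣ F ∩ G ∣
  𝓐𝓑-meets-𝓒 F∈𝓐𝓑@(inj₁ F∈𝓐) G∈𝓒 with 𝓐-point F∈𝓐
  ... | o , o∈F∩M∖X = 𝓒-meet (𝓐𝓑-X F∈𝓐𝓑) G∈𝓒 (∩ˡ (∩ˡ o∈F∩M∖X))
                        (𝓒-core G∈𝓒 (∩⁺ (∩ʳ (∩ˡ o∈F∩M∖X)) (∩ʳ o∈F∩M∖X))) (x∈∁p⇒x∉p (∩ʳ o∈F∩M∖X))
  𝓐𝓑-meets-𝓒 F∈𝓐𝓑@(inj₂ F∈𝓑) G∈𝓒@(_ , G⊆C , _) with 𝓒-outside-point G∈𝓒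
  ... | o , o∈G∖M = 𝓒-meet (𝓐𝓑-X F∈𝓐𝓑) G∈𝓒 (𝓑-rim F∈𝓑 (∩⁺ (G⊆C (∩ˡ o∈G∖M)) (∩ʳ o∈G∖M)))
                      (∩ˡ o∈G∖M) (λ o∈X → x∈∁p⇒x∉p (∩ʳ o∈G∖M) (X⊆M o∈X))

  -- Two members of 𝓒 share M ∖ X (at least two points) and at least t − 2 points of X.
  𝓒-meets-𝓒 : ∀ {G G′} → 𝓒 k t X M C G → 𝓒 k t X M C G′ → t ≤ ∣ G ∩ G′ ∣
  𝓒-meets-𝓒 {G} {G′} G∈𝓒 G′∈𝓒 = begin
    t                                     ≡⟨ sym (𝓒-X G′∈𝓒) ⟩
    suc ∣ G′ ∩ X ∣                        ≤⟨ s≤s G′-bound ⟩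
    suc (suc ∣ (G ∩ X) ∩ (G′ ∩ X) ∣)      ≡⟨ +-comm 2 _ ⟩
    ∣ (G ∩ X) ∩ (G′ ∩ X) ∣ + 2            ≤⟨ +-mono-≤ (p⊆q⇒∣p∣≤∣q∣ in-X) (≤-trans 2≤r (p⊆q⇒∣p∣≤∣q∣ off-X)) ⟩
    ∣ (G ∩ G′) ∩ X ∣ + ∣ (G ∩ G′) ∩ ∁ X ∣  ≡⟨ sym (∣∩∣+∣∩∁∣ (G ∩ G′) X) ⟩
    ∣ G ∩ G′ ∣                            ∎
    where
      open ≤-Reasoning
      in-X : (G ∩ X) ∩ (G′ ∩ X) ⊆ (G ∩ G′) ∩ X
      in-X p = ∩⁺ (∩⁺ (∩ˡ (∩ˡ p)) (∩ˡ (∩ʳ p))) (∩ʳ (∩ʳ p))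
      off-X : M ∩ ∁ X ⊆ (G ∩ G′) ∩ ∁ X
      off-X p = ∩⁺ (∩⁺ (𝓒-core G∈𝓒 p) (𝓒-core G′∈𝓒 p)) (∩ʳ p)
      G′-bound : ∣ G′ ∩ X ∣ ≤ suc ∣ (G ∩ X) ∩ (G′ ∩ X) ∣
      G′-bound = +-cancelˡ-≤ ∣ G ∩ X ∣ _ _ (begin
        ∣ G ∩ X ∣ + ∣ G′ ∩ X ∣                 ≤⟨ ∣∣+∣∣≤∣∣+∣∩∣ {A = G ∩ X} {G′ ∩ X} ∩ʳ ∩ʳ ⟩
        ∣ X ∣ + ∣ (G ∩ X) ∩ (G′ ∩ X) ∣         ≡⟨ cong (_+ ∣ (G ∩ X) ∩ (G′ ∩ X) ∣) (trans ∣X∣ (sym (𝓒-X G∈𝓒))) ⟩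
        suc ∣ G ∩ X ∣ + ∣ (G ∩ X) ∩ (G′ ∩ X) ∣ ≡⟨ sym (+-suc _ _) ⟩
        ∣ G ∩ X ∣ + suc ∣ (G ∩ X) ∩ (G′ ∩ X) ∣ ∎)

  𝓗₁-uniform : IsUniform k (𝓗₁ k t X M C)
  𝓗₁-uniform F (inj₁ (∣F∣ , _)) = ∣F∣
  𝓗₁-uniform F (inj₂ (inj₁ (∣F∣ , _))) = ∣F∣
  𝓗₁-uniform F (inj₂ (inj₂ (∣F∣ , _))) = ∣F∣

  𝓗₁-intersecting : IsTIntersecting t (𝓗₁ k t X M C)
  𝓗₁-intersecting F G F∈𝓗₁ G∈𝓗₁ = meets F∈𝓗₁ G∈𝓗₁
    where
      X-part-meets : 𝓐 k t X M F ⊎ 𝓑 k t X M C F → 𝓗₁ k t X M C G → t ≤ ∣ F ∩ G ∣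
      X-part-meets F∈𝓐𝓑 (inj₂ (inj₂ G∈𝓒)) = 𝓐𝓑-meets-𝓒 F∈𝓐𝓑 G∈𝓒
      X-part-meets F∈𝓐𝓑 (inj₁ G∈𝓐) =
        subst (_≤ ∣ F ∩ G ∣) ∣X∣ (common-core (𝓐𝓑-X F∈𝓐𝓑) (𝓐𝓑-X (inj₁ G∈𝓐)))
      X-part-meets F∈𝓐𝓑 (inj₂ (inj₁ G∈𝓑)) =
        subst (_≤ ∣ F ∩ G ∣) ∣X∣ (common-core (𝓐𝓑-X F∈𝓐𝓑) (𝓐𝓑-X (inj₂ G∈𝓑)))
      meets : 𝓗₁ k t X M C F → 𝓗₁ k t X M C G → t ≤ ∣ F ∩ G ∣
      meets (inj₁ F∈𝓐) G∈𝓗₁ = X-part-meets (inj₁ F∈𝓐) G∈𝓗₁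
      meets (inj₂ (inj₁ F∈𝓑)) G∈𝓗₁ = X-part-meets (inj₂ F∈𝓑) G∈𝓗₁
      meets (inj₂ (inj₂ F∈𝓒)) (inj₁ G∈𝓐) = ∩-sym-≤ G F (𝓐𝓑-meets-𝓒 (inj₁ G∈𝓐) F∈𝓒)
      meets (inj₂ (inj₂ F∈𝓒)) (inj₂ (inj₁ G∈𝓑)) = ∩-sym-≤ G F (𝓐𝓑-meets-𝓒 (inj₂ G∈𝓑) F∈𝓒)
      meets (inj₂ (inj₂ F∈𝓒)) (inj₂ (inj₂ G∈𝓒)) = 𝓒-meets-𝓒 F∈𝓒 G∈𝓒

-- The hypotheses of Lemma 2.4, except τ_t(𝓣) = t (not needed) and 2k ≤ n (used only at the end).
module Setting (n k t : ℕ) (1≤t : 1 ≤ t) (t≤k∸2 : t ≤ k ∸ 2)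
  (𝓕 : Family n) (max𝓕 : IsMaximalTIntersecting k t 𝓕)
  (τ𝓕 : CoveringNumber≡ t 𝓕 (t + 1))
  (M : Subset n)
  (M-def : ∀ i → (i ∈ M → Σ (Subset n) (λ T → 𝓣 t 𝓕 T × i ∈ T)) × (Σ (Subset n) (λ T → 𝓣 t 𝓕 T × i ∈ T) → i ∈ M))
  (∣M∣ : ∣ M ∣ ≡ k)
  (X : Subset n) (∣X∣ : ∣ X ∣ ≡ t) (X⊆𝓣 : ∀ T → 𝓣 t 𝓕 T → X ⊆ T)
  (C : Subset n)
  (C-def : ∀ i → (i ∈ C → (i ∈ M ⊎ Σ (Subset n) (λ F → 𝓕 F × ¬ (X ⊆ F) × i ∈ F))) × ((i ∈ M ⊎ Σ (Subset n) (λ F → 𝓕 F × ¬ (X ⊆ F) × i ∈ F)) → i ∈ C))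
  where

  uniform : IsUniform k 𝓕
  uniform = proj₁ max𝓕

  intersecting : IsTIntersecting t 𝓕
  intersecting = proj₁ (proj₂ max𝓕)

  t+2≤k : t + 2 ≤ k
  t+2≤k = ≤∸2⇒+2≤ 1≤t t≤k∸2

  t≤k : t ≤ k
  t≤k = ≤-trans (m≤m+n t 2) t+2≤k

  -- A minimum t-cover of 𝓕 has size t + 1, so it lies in 𝓣; hence X ⊆ M.
  X⊆M : X ⊆ M
  X⊆M {i} i∈X = proj₂ (M-def i) (T₀ , T₀∈𝓣 , X⊆𝓣 T₀ T₀∈𝓣 i∈X)
    where
      T₀ : Subset n
      T₀ = proj₁ (proj₁ τ𝓕)
      T₀∈𝓣 : 𝓣 t 𝓕 T₀
      T₀∈𝓣 = proj₂ (proj₂ (proj₁ τ𝓕)) , proj₁ (proj₂ (proj₁ τ𝓕))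

  M⊆C : M ⊆ C
  M⊆C {i} i∈M = proj₂ (C-def i) (inj₁ i∈M)

  open H₁-Structure 1≤t t+2≤k ∣X∣ ∣M∣ X⊆M M⊆C

  -- For m ∈ M ∖ X the set X ∪ {m} contains, hence equals, the member of 𝓣 through m, so it is a
  -- t-cover; conversely a t-cover X ∪ {o} with o ∉ X lies in 𝓣, so o ∈ M.
  point-cover : ∀ {m} → m ∈ M → m ∉ X → IsTCover t 𝓕 (X ∪ ⁅ m ⁆)
  point-cover {m} m∈M m∉X with proj₁ (M-def m) m∈M
  ... | T , (∣T∣ , T-covers) , m∈T = cover-mono T⊆X∪m T-covers
    where
      T⊆X∪m : T ⊆ X ∪ ⁅ m ⁆
      T⊆X∪m = one-point-extension (X⊆𝓣 T (∣T∣ , T-covers))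
                (trans ∣T∣ (trans (+-comm t 1) (cong suc (sym ∣X∣)))) m∈T m∉X

  point-cover⇒∈M : ∀ {o} → o ∉ X → IsTCover t 𝓕 (X ∪ ⁅ o ⁆) → o ∈ M
  point-cover⇒∈M {o} o∉X covers =
    proj₂ (M-def o) (X ∪ ⁅ o ⁆ , (∣X∪o∣ , covers) , x∈p∪q⁺ (inj₂ (x∈⁅x⁆ o)))
    where
      ∣X∪o∣ : ∣ X ∪ ⁅ o ⁆ ∣ ≡ t + 1
      ∣X∪o∣ = trans (∣∪⁅⁆∣ o∉X) (trans (cong suc ∣X∣) (+-comm 1 t))

  M∖X-point : ∃ λ m → m ∈ M ∩ ∁ X
  M∖X-point = ∣∣≥1⇒∃∈ (M ∩ ∁ X) (≤-trans (s≤s z≤n) 2≤r)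

  point-trace : ∀ {F m} → m ∉ F → (X ∪ ⁅ m ⁆) ∩ F ⊆ F ∩ X
  point-trace {F} {m} m∉F p with x∈p∪q⁻ X ⁅ m ⁆ (∩ˡ p)
  ... | inj₁ i∈X = ∩⁺ (∩ʳ p) i∈X
  ... | inj₂ i∈m = ⊥-elim (m∉F (subst (_∈ F) (x∈⁅y⁆⇒x≡y m i∈m) (∩ʳ p)))

  outer-core : ∀ {F} → 𝓕 F → ¬ (X ⊆ F) → M ∩ ∁ X ⊆ F
  outer-core {F} F∈𝓕 X⊈F {m} m∈M∖X with m ∈? F
  ... | yes m∈F = m∈F
  ... | no  m∉F = ⊥-elim (<⇒≱ (subst (∣ F ∩ X ∣ <_) ∣X∣ (⊈⇒∣∩∣< X⊈F))
         (≤-trans (point-cover (∩ˡ m∈M∖X) (x∈∁p⇒x∉p (∩ʳ m∈M∖X)) F F∈𝓕)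
                  (p⊆q⇒∣p∣≤∣q∣ (point-trace m∉F))))

  outer-X : ∀ {F} → 𝓕 F → ¬ (X ⊆ F) → suc ∣ F ∩ X ∣ ≡ t
  outer-X {F} F∈𝓕 X⊈F = ≤-antisym (subst (∣ F ∩ X ∣ <_) ∣X∣ (⊈⇒∣∩∣< X⊈F)) (begin
    t                         ≤⟨ point-cover (∩ˡ m∈M∖X) m∉X F F∈𝓕 ⟩
    ∣ (X ∪ ⁅ m ⁆) ∩ F ∣       ≤⟨ p⊆q⇒∣p∣≤∣q∣ trace ⟩
    ∣ (F ∩ X) ∪ ⁅ m ⁆ ∣       ≤⟨ ∣∪⁅⁆∣≤ (F ∩ X) m ⟩
    suc ∣ F ∩ X ∣             ∎)
    where
      open ≤-Reasoning
      m : Fin n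
      m = proj₁ M∖X-point
      m∈M∖X : m ∈ M ∩ ∁ X
      m∈M∖X = proj₂ M∖X-point
      m∉X : m ∉ X
      m∉X = x∈∁p⇒x∉p (∩ʳ m∈M∖X)
      trace : (X ∪ ⁅ m ⁆) ∩ F ⊆ (F ∩ X) ∪ ⁅ m ⁆
      trace p with x∈p∪q⁻ X ⁅ m ⁆ (∩ˡ p)
      ... | inj₁ i∈X = x∈p∪q⁺ (inj₁ (∩⁺ (∩ʳ p) i∈X))
      ... | inj₂ i∈m = x∈p∪q⁺ (inj₂ i∈m)

  outer∈𝓒 : ∀ {F} → 𝓕 F → ¬ (X ⊆ F) → 𝓒 k t X M C F
  outer∈𝓒 {F} F∈𝓕 X⊈F = 𝓒-intro (uniform F F∈𝓕) F⊆C (outer-X F∈𝓕 X⊈F) (outer-core F∈𝓕 X⊈F)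
    where
      F⊆C : F ⊆ C
      F⊆C {i} i∈F = proj₂ (C-def i) (inj₂ (F , F∈𝓕 , X⊈F , i∈F))

  inner∈𝓑 : ∀ {F} → 𝓕 F → X ⊆ F → ∣ F ∩ M ∣ ≤ t → 𝓑 k t X M C F
  inner∈𝓑 {F} F∈𝓕 X⊆F ∣F∩M∣≤t = 𝓑-intro (uniform F F∈𝓕) F∩M≡X rim
    where
      X⊆F∩M : X ⊆ F ∩ M
      X⊆F∩M p = ∩⁺ (X⊆F p) (X⊆M p)
      F∩M≡X : F ∩ M ≡ X
      F∩M≡X = ⊆-antisym (⊆-∣∣-≥⇒⊇ X⊆F∩M (subst (∣ F ∩ M ∣ ≤_) (sym ∣X∣) ∣F∩M∣≤t)) X⊆F∩M
      -- The outside point o of an outer member D lies in F, else F ∩ D ⊆ D ∩ X is too small.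
      rim : C ∩ ∁ M ⊆ F
      rim {o} o∈C∖M with proj₁ (C-def o) (∩ˡ o∈C∖M)
      ... | inj₁ o∈M = ⊥-elim (x∈∁p⇒x∉p (∩ʳ o∈C∖M) o∈M)
      ... | inj₂ (D , D∈𝓕 , X⊈D , o∈D) with o ∈? F
      ...   | yes o∈F = o∈F
      ...   | no  o∉F = ⊥-elim (<⇒≱ (≤-reflexive (outer-X D∈𝓕 X⊈D))
                                     (≤-trans (intersecting F D F∈𝓕 D∈𝓕) (p⊆q⇒∣p∣≤∣q∣ F∩D⊆D∩X)))
        where
          F∩D⊆D∩X : F ∩ D ⊆ D ∩ X
          F∩D⊆D∩X {i} p with i ∈? M
          ... | yes i∈M = ∩⁺ (∩ʳ p) (subst (i ∈_) F∩M≡X (∩⁺ (∩ˡ p) i∈M))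
          ... | no  i∉M = ⊥-elim (o∉F (subst (_∈ F) i≡o (∩ˡ p)))
            where
              i≡o : i ≡ o
              i≡o = ∣∣≤1⇒≡ (D ∩ ∁ M) (≤-reflexive (𝓒-outside (outer∈𝓒 D∈𝓕 X⊈D)))
                      (∩⁺ (∩ʳ p) (x∉p⇒x∈∁p i∉M)) (∩⁺ o∈D (∩ʳ o∈C∖M))

  𝓕⊑𝓗₁ : 𝓕 ⊑ 𝓗₁ k t X M C
  𝓕⊑𝓗₁ F F∈𝓕 with X ⊆? F
  ... | no  X⊈F = inj₂ (inj₂ (outer∈𝓒 F∈𝓕 X⊈F))
  ... | yes X⊆F with t + 1 ≤? ∣ F ∩ M ∣
  ...   | yes heavy = inj₁ (uniform F F∈𝓕 , X⊆F , heavy)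
  ...   | no  light = inj₂ (inj₁ (inner∈𝓑 F∈𝓕 X⊆F
                          (m<1+n⇒m≤n (subst (∣ F ∩ M ∣ <_) (+-comm t 1) (≰⇒> light)))))

  𝓕≐𝓗₁ : 𝓕 ≐ 𝓗₁ k t X M C
  𝓕≐𝓗₁ = maximal-≐ max𝓕 𝓗₁-uniform 𝓗₁-intersecting 𝓕⊑𝓗₁

  -- If C ∖ M has at most one point o, then X ∪ {o} would be a t-cover of 𝓕 lying in 𝓣
  -- although o ∉ M; so every member of 𝓕 contains X.
  thin-rim⇒X⊆ : ∣ C ∩ ∁ M ∣ ≤ 1 → ∀ {F} → 𝓕 F → X ⊆ F
  thin-rim⇒X⊆ thin {F} F∈𝓕 with X ⊆? F
  ... | yes X⊆F = X⊆F
  ... | no  X⊈F with 𝓒-outside-point (outer∈𝓒 F∈𝓕 X⊈F)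
  ...   | o , o∈F∖M = ⊥-elim (x∈∁p⇒x∉p (∩ʳ o∈F∖M) (point-cover⇒∈M o∉X covers))
    where
      o∈rim : o ∈ C ∩ ∁ M
      o∈rim = ∩⁺ (proj₂ (C-def o) (inj₂ (F , F∈𝓕 , X⊈F , ∩ˡ o∈F∖M))) (∩ʳ o∈F∖M)
      o∉X : o ∉ X
      o∉X o∈X = x∈∁p⇒x∉p (∩ʳ o∈F∖M) (X⊆M o∈X)
      covers : IsTCover t 𝓕 (X ∪ ⁅ o ⁆)
      covers G G∈𝓕 with X ⊆? G
      ... | yes X⊆G = subst (_≤ _) ∣X∣ (common-core (p⊆p∪q ⁅ o ⁆) X⊆G)
      ... | no  X⊈G with 𝓒-outside-point (outer∈𝓒 G∈𝓕 X⊈G)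
      ...   | o′ , o′∈G∖M = 𝓒-meet (p⊆p∪q ⁅ o ⁆) (outer∈𝓒 G∈𝓕 X⊈G) (x∈p∪q⁺ (inj₂ (x∈⁅x⁆ o))) o∈G o∉X
        where
          o′∈rim : o′ ∈ C ∩ ∁ M
          o′∈rim = ∩⁺ (proj₂ (C-def o′) (inj₂ (G , G∈𝓕 , X⊈G , ∩ˡ o′∈G∖M))) (∩ʳ o′∈G∖M)
          o∈G : o ∈ G
          o∈G = subst (_∈ G) (∣∣≤1⇒≡ (C ∩ ∁ M) thin o′∈rim o∈rim) (∩ˡ o′∈G∖M)

  -- |C| ≥ k + 2: otherwise C ∖ M has at most one point and X is a t-cover of size t < τ_t(𝓕).
  k+2≤∣C∣ : k + 2 ≤ ∣ C ∣
  k+2≤∣C∣ with k + 2 ≤? ∣ C ∣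
  ... | yes k+2≤c = k+2≤c
  ... | no  k+2≰c = ⊥-elim (m+1+n≰m t (subst (t + 1 ≤_) ∣X∣ (proj₂ τ𝓕 X X-covers)))
    where
      thin : ∣ C ∩ ∁ M ∣ ≤ 1
      thin = ≤-pred (+-cancelˡ-≤ k _ 2
               (subst (_≤ k + 2) (trans (cong suc ∣C∣≡k+∣C∖M∣) (sym (+-suc k _))) (≰⇒> k+2≰c)))
      X-covers : IsTCover t 𝓕 X
      X-covers G G∈𝓕 = subst (_≤ ∣ X ∩ G ∣) ∣X∣ (common-core ⊆-refl (thin-rim⇒X⊆ thin G∈𝓕))

  module Large (large : ¬ (∣ C ∣ ≤ 2 * k ∸ t)) where

    -- 𝓑 is empty, so every member of 𝓕 has at least t + 1 points in M.
    heavy : ∀ {F} → 𝓕 F → t + 1 ≤ ∣ F ∩ M ∣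
    heavy {F} F∈𝓕 with 𝓕⊑𝓗₁ F F∈𝓕
    ... | inj₁ (_ , _ , t+1≤∣F∩M∣) = t+1≤∣F∩M∣
    ... | inj₂ (inj₁ F∈𝓑) = ⊥-elim (large (𝓑-bound F∈𝓑))
    ... | inj₂ (inj₂ (_ , _ , _ , ∣F∩M∣)) =
      subst (t + 1 ≤_) (sym ∣F∩M∣) (m+n≤o⇒m≤o∸n (t + 1) (subst (_≤ k) (sym (+-assoc t 1 1)) t+2≤k))

    X-point : ∃ λ x → x ∈ X
    X-point = ∣∣≥1⇒∃∈ X (subst (1 ≤_) (sym ∣X∣) 1≤t)

    x : Fin n
    x = proj₁ X-point

    x∈X : x ∈ X
    x∈X = proj₂ X-point

    M⁻ : Subset n
    M⁻ = M ∩ ∁ ⁅ x ⁆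

    x∉M⁻ : x ∉ M⁻
    x∉M⁻ p = x∈∁p⇒x∉p (∩ʳ p) (x∈⁅x⁆ x)

    ∣M⁻∣ : suc ∣ M⁻ ∣ ≡ k
    ∣M⁻∣ = trans (∣∩∁⁅⁆∣ (X⊆M x∈X)) ∣M∣

    meets-M⁻ : ∀ {F} → 𝓕 F → t ≤ ∣ F ∩ M⁻ ∣
    meets-M⁻ {F} F∈𝓕 = ≤-pred (begin
      suc t                         ≡⟨ +-comm 1 t ⟩
      t + 1                         ≤⟨ heavy F∈𝓕 ⟩
      ∣ F ∩ M ∣                     ≤⟨ ∣∩∁⁅⁆∣≥ (F ∩ M) x ⟩
      suc ∣ (F ∩ M) ∩ ∁ ⁅ x ⁆ ∣     ≡⟨ cong (λ S → suc ∣ S ∣) (∩-assoc F M (∁ ⁅ x ⁆)) ⟩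
      suc ∣ F ∩ M⁻ ∣                ∎)
      where open ≤-Reasoning

    -- For y ∉ C, the k-set M⁻ ∪ {y} t-intersects 𝓕, so by maximality it is a member
    -- not containing X, which puts y into C.
    C-full : ∀ y → y ∈ C
    C-full y with y ∈? C
    ... | yes y∈C = y∈C
    ... | no  y∉C = ⊥-elim (y∉C (proj₂ (C-def y) (inj₂ (G , G∈𝓕 , X⊈G , x∈p∪q⁺ (inj₂ (x∈⁅x⁆ y))))))
      where
        G : Subset n
        G = M⁻ ∪ ⁅ y ⁆
        y∉M⁻ : y ∉ M⁻
        y∉M⁻ p = y∉C (M⊆C (∩ˡ p))
        G∈𝓕 : 𝓕 G
        G∈𝓕 = maximal-adjoin max𝓕 t≤k G (trans (∣∪⁅⁆∣ y∉M⁻) ∣M⁻∣)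
                (λ F F∈𝓕 → ≤-trans (meets-M⁻ F∈𝓕) (p⊆q⇒∣p∣≤∣q∣ (F∩M⁻⊆F∩G F)))
          where
            F∩M⁻⊆F∩G : (F : Subset n) → F ∩ M⁻ ⊆ F ∩ G
            F∩M⁻⊆F∩G F p = ∩⁺ (∩ˡ p) (p⊆p∪q ⁅ y ⁆ (∩ʳ p))
        X⊈G : ¬ (X ⊆ G)
        X⊈G X⊆G with x∈p∪q⁻ M⁻ ⁅ y ⁆ (X⊆G x∈X)
        ... | inj₁ x∈M⁻ = x∉M⁻ x∈M⁻
        ... | inj₂ x∈y = y∉C (subst (_∈ C) (x∈⁅y⁆⇒x≡y y x∈y) (M⊆C (X⊆M x∈X)))

    C≡⊤ : C ≡ ⊤
    C≡⊤ = ⊆-antisym ⊆⊤ (λ {y} _ → C-full y)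

    -- If t = k − 2 then M⁻ has t + 1 points and t-covers 𝓕, so M⁻ ∈ 𝓣; but x ∉ M⁻.
    t≢k∸2 : t ≢ k ∸ 2
    t≢k∸2 t≡k∸2 = x∉M⁻ (X⊆𝓣 M⁻ (∣M⁻∣≡t+1 , M⁻-covers) x∈X)
      where
        M⁻-covers : IsTCover t 𝓕 M⁻
        M⁻-covers F F∈𝓕 = ∩-sym-≤ F M⁻ (meets-M⁻ F∈𝓕)
        ∣M⁻∣≡t+1 : ∣ M⁻ ∣ ≡ t + 1
        ∣M⁻∣≡t+1 = suc-injective (begin
          suc ∣ M⁻ ∣      ≡⟨ ∣M⁻∣ ⟩
          k               ≡⟨ sym (m∸n+n≡m (≤-trans (m≤n+m 2 t) t+2≤k)) ⟩
          k ∸ 2 + 2       ≡⟨ cong (_+ 2) (sym t≡k∸2) ⟩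
          t + 2           ≡⟨ +-suc t 1 ⟩
          suc (t + 1)     ∎)
          where open ≡-Reasoning

  full⇒large : 2 * k ≤ n → ∣ C ∣ ≡ n → ¬ (∣ C ∣ ≤ 2 * k ∸ t)
  full⇒large 2k≤n ∣C∣≡n ∣C∣≤ = <⇒≱ (≤-trans (∸-monoʳ-< {o = 0} 1≤t (≤-trans t≤k (m≤m+n k _))) 2k≤n)
                                    (subst (_≤ 2 * k ∸ t) ∣C∣≡n ∣C∣≤)

lemma2p4 : (n k t : ℕ) → 1 ≤ t → t ≤ k ∸ 2 → 2 * k ≤ n →
    (𝓕 : Family n) → IsMaximalTIntersecting k t 𝓕 →
    CoveringNumber≡ t 𝓕 (t + 1) →
    CoveringNumber≡ t (𝓣 t 𝓕) t →
    (M : Subset n) → (∀ i → (i ∈ M → Σ (Subset n) (λ T → 𝓣 t 𝓕 T × i ∈ T)) × (Σ (Subset n) (λ T → 𝓣 t 𝓕 T × i ∈ T) → i ∈ M)) →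
    ∣ M ∣ ≡ k →
    (X : Subset n) → ∣ X ∣ ≡ t → (∀ T → 𝓣 t 𝓕 T → X ⊆ T) →
    (C : Subset n) → (∀ i → (i ∈ C → (i ∈ M ⊎ Σ (Subset n) (λ F → 𝓕 F × ¬ (X ⊆ F) × i ∈ F))) × ((i ∈ M ⊎ Σ (Subset n) (λ F → 𝓕 F × ¬ (X ⊆ F) × i ∈ F)) → i ∈ C)) →
    ((k + 2 ≤ ∣ C ∣ × ∣ C ∣ ≤ 2 * k ∸ t) ⊎ ∣ C ∣ ≡ n)
    × ((k + 2 ≤ ∣ C ∣ × ∣ C ∣ ≤ 2 * k ∸ t) → 𝓕 ≐ 𝓗₁ k t X M C)
    × (∣ C ∣ ≡ n → (t ≢ k ∸ 2) × 𝓕 ≐ 𝓗₁ k t X M ⊤)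
lemma2p4 n k t 1≤t t≤k∸2 2k≤n 𝓕 max𝓕 τ𝓕 _ M M-def ∣M∣ X ∣X∣ X⊆𝓣 C C-def =
  dichotomy , (λ _ → 𝓕≐𝓗₁) , full-case
  where
    open Setting n k t 1≤t t≤k∸2 𝓕 max𝓕 τ𝓕 M M-def ∣M∣ X ∣X∣ X⊆𝓣 C C-def

    dichotomy : (k + 2 ≤ ∣ C ∣ × ∣ C ∣ ≤ 2 * k ∸ t) ⊎ ∣ C ∣ ≡ n
    dichotomy with ∣ C ∣ ≤? 2 * k ∸ t
    ... | yes ∣C∣≤ = inj₁ (k+2≤∣C∣ , ∣C∣≤)
    ... | no  large = inj₂ (trans (cong ∣_∣ (Large.C≡⊤ large)) (∣⊤∣≡n n))

    full-case : ∣ C ∣ ≡ n → (t ≢ k ∸ 2) × 𝓕 ≐ 𝓗₁ k t X M ⊤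
    full-case ∣C∣≡n = Large.t≢k∸2 large , subst (λ D → 𝓕 ≐ 𝓗₁ k t X M D) (Large.C≡⊤ large) 𝓕≐𝓗₁
      where
        large : ¬ (∣ C ∣ ≤ 2 * k ∸ t)
        large = full⇒large 2k≤n ∣C∣≡n
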